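{- Let $G$ be a directed graph, $R$ a set of vertices of $G$, and $F, F'$ two $R$-directed forests in $G$ with $|F|=|F'|=k$. Then there is a sequence $\langle F=F_0, F_1, \ldots, F_\ell=F'\rangle$ of $R$-directed forests in $G$ such that $|A(F_i)\setminus A(F_{i+1})| = |A(F_{i+1})\setminus A(F_i)|=1$ for all $0\le i<\ell$, and $\ell\le k$.
   Context: A directed tree is a directed graph whose underlying undirected graph is a tree and in which every vertex except one vertex (the root) has in-degree exactly $1$. A directed forest is a disjoint union of directed trees; it is called an $R$-directed forest if $R$ is the set of roots of its weakly connected components. $|F|$ denotes the number of arcs of $F$. -}

module Defs where

open import Data.Nat using (ℕ; zero; suc; _≤_)
open import Data.Fin using (Fin)
open import Data.Fin.Subset using (Subset; _∈_; _∉_; _─_; ∣_∣)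
open import Data.List using (List; []; _∷_)
open import Data.List.Relation.Unary.Unique.Propositional using (Unique)
open import Data.Product using (_×_; ∃; ∃-syntax; Σ-syntax)
open import Data.Sum using (_⊎_)
open import Relation.Binary.PropositionalEquality using (_≡_)
open import Relation.Nullary using (¬_)

-- A (finite) directed graph: vertices Fin n, arcs Fin m, each arc a
-- goes from tail a to head a (loops / parallel arcs not excluded).
record Digraph (n m : ℕ) : Set where
  field
    tail : Fin m → Fin n
    head : Fin m → Fin n
open Digraph public

record Subgraph (n m : ℕ) : Set where
  constructor ⟨_,_⟩
  field
    V : Subset n
    A : Subset m
open Subgraph public

module _ {n m : ℕ} (G : Digraph n m) where

  IsSubgraph : Subgraph n m → Set
  IsSubgraph F = ∀ a → a ∈ A F → (tail G a ∈ V F) × (head G a ∈ V F)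

  Joins : Fin m → Fin n → Fin n → Set
  Joins a u w = (tail G a ≡ u × head G a ≡ w) ⊎ (head G a ≡ u × tail G a ≡ w)

  data UWalk (S : Subset m) : Fin n → Fin n → List (Fin m) → Set where
    []  : ∀ {v} → UWalk S v v []
    _∷_ : ∀ {a u w x as} → (a ∈ S × Joins a u w) → UWalk S w x as →
          UWalk S u x (a ∷ as)

  -- underlying undirected graph has no cycle: every closed walk with
  -- pairwise distinct arcs is empty
  UAcyclic : Subset m → Set
  UAcyclic S = ∀ {v as} → UWalk S v v as → Unique as → as ≡ []

  InDeg≤1 : Subset m → Set
  InDeg≤1 S = ∀ a b → a ∈ S → b ∈ S → head G a ≡ head G b → a ≡ b

  InDeg0 : Subset m → Fin n → Set
  InDeg0 S v = ∀ a → a ∈ S → ¬ (head G a ≡ v)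

  -- directed forest (disjoint union of directed trees): underlying graph is a
  -- forest and every vertex has in-degree ≤ 1; the root of each component is
  -- its (unique) vertex of in-degree 0.
  DirectedForest : Subgraph n m → Set
  DirectedForest F = IsSubgraph F × UAcyclic (A F) × InDeg≤1 (A F)

  -- the set of roots of its components is exactly R
  RootsAre : Subset n → Subgraph n m → Set
  RootsAre R F = ∀ v → (v ∈ R → v ∈ V F × InDeg0 (A F) v)
                     × (v ∈ V F → InDeg0 (A F) v → v ∈ R)

  RDirectedForest : Subset n → Subgraph n m → Set
  RDirectedForest R F = DirectedForest F × RootsAre R F

  size : Subgraph n m → ℕ
  size F = ∣ A F ∣

{-# OPTIONS --safe #-}
-- Write A′ for the arc set of F′. We grow a set P ⊆ A′ of arcs shared by the current forest
-- and F′ that stays rooted: the tail of each arc of P lies in R or is the head of another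
-- arc of P. Since A′ is acyclic, while P ≠ A′ some arc e ∈ A′ ∖ P has its tail reached by P.
-- If e is already in the current forest it joins P for free. Otherwise one exchange
-- A - r + e with r ∉ P gives another R-directed forest: if head e is a vertex of the forest,
-- r is its in-arc and the subtree below head e, which cannot contain the P-reached vertex
-- tail e, is re-hung from tail e; if not, r enters a leaf outside P and that leaf is dropped.
-- So each of the k arcs of A′ costs at most one step, and once P = A′ the forests coincide.

module Submission where

open import Defs
open import Data.Nat using (ℕ; zero; suc; _≤_; _<_; _+_; z≤n; s≤s; _≤?_)
open import Data.Nat.Properties
  using (≰⇒>; <-irrefl; <-≤-trans; ≤-reflexive; m≤n⇒m≤1+n; +-identityʳ; +-suc; m<m+n)
open import Data.Fin using (Fin; zero; suc; fromℕ; inject₁; _≟_)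
open import Data.Fin.Properties as Finₚ using (any?; all?; pigeonhole)
open import Data.Fin.Subset using (Subset; _∈_; _∉_; _─_; ∣_∣; _⊆_; inside; outside; ⁅_⁆; ⊥)
open import Data.Fin.Subset.Properties
  using ( _∈?_; ⊆-antisym; ⊆-min; ∣⁅x⁆∣≡1; x∈⁅x⁆; x∈⁅y⁆⇒x≡y; p⊆q⇒∣p∣≤∣q∣; p⊂q⇒∣p∣<∣q∣
        ; x∈p∧x∉q⇒x∈p─q; p─q⊆p; ∉⊥; ∣⊥∣≡0)
open import Data.Vec using (_∷_; here; there; _[_]≔_)
open import Data.Vec.Properties using ([]=⇒lookup; lookup⇒[]=; []≔-updates; []≔-minimal; lookup∘update′)
open import Data.List using (List; []; _∷_; _++_; length; lookup)
open import Data.List.Membership.Propositional using () renaming (_∈_ to _∈ₗ_; _∉_ to _∉ₗ_)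
open import Data.List.Membership.Propositional.Properties using (∈-lookup; ∈-++⁻; ∈-++⁺ˡ; ∈-++⁺ʳ)
open import Data.List.Relation.Binary.Subset.Propositional using () renaming (_⊆_ to _⊆ₗ_)
open import Data.List.Relation.Unary.Any as Any using (here; there)
open import Data.List.Relation.Unary.All.Properties using (¬Any⇒All¬)
open import Data.List.Relation.Unary.All as All using (All; []; _∷_)
open import Data.List.Relation.Unary.AllPairs using ([]; _∷_)
open import Data.List.Relation.Unary.Unique.Propositional using (Unique)
open import Data.Product using (_×_; _,_; proj₁; proj₂; Σ-syntax; ∃-syntax)
open import Data.Sum using (_⊎_; inj₁; inj₂; [_,_]′; swap; map₂)
open import Data.Empty renaming (⊥ to Empty) using (⊥-elim)
open import Function using (_∘_)
open import Relation.Binary.PropositionalEquality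
  using (_≡_; _≢_; refl; sym; trans; cong; cong₂; subst)
open import Relation.Nullary using (¬_; Dec; yes; no)
open import Relation.Nullary.Decidable using (_×-dec_; ¬?; _→-dec_)

private
  variable
    k n m : ℕ

-- Subsets

x∈p[x]≔inside : ∀ (p : Subset k) x → x ∈ p [ x ]≔ inside
x∈p[x]≔inside = []≔-updates

x∉p[x]≔outside : ∀ (p : Subset k) x → x ∉ p [ x ]≔ outside
x∉p[x]≔outside p x x∈ with trans (sym ([]=⇒lookup x∈)) ([]=⇒lookup ([]≔-updates p x))
... | ()

y∈p⇒y∈p[x]≔s : ∀ {p : Subset k} {x y} s → y ≢ x → y ∈ p → y ∈ p [ x ]≔ s
y∈p⇒y∈p[x]≔s {p = p} {x} {y} s = []≔-minimal p y x

y∈p[x]≔s⇒y∈p : ∀ {p : Subset k} {x y} s → y ≢ x → y ∈ p [ x ]≔ s → y ∈ p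
y∈p[x]≔s⇒y∈p {p = p} {x} {y} s y≢x y∈ =
  lookup⇒[]= y p (trans (sym (lookup∘update′ y≢x p s)) ([]=⇒lookup y∈))

y∈p[x]≔outside⁻ : ∀ {p : Subset k} {x y} → y ∈ p [ x ]≔ outside → y ∈ p × y ≢ x
y∈p[x]≔outside⁻ {p = p} {x} y∈ = y∈p[x]≔s⇒y∈p outside y≢x y∈ , y≢x
  where
  y≢x : _ ≢ x
  y≢x refl = x∉p[x]≔outside p x y∈

∣p[x]≔inside∣≡1+∣p∣ : ∀ (p : Subset k) x → x ∉ p → ∣ p [ x ]≔ inside ∣ ≡ suc ∣ p ∣
∣p[x]≔inside∣≡1+∣p∣ (inside ∷ p) zero x∉p = ⊥-elim (x∉p here)
∣p[x]≔inside∣≡1+∣p∣ (outside ∷ p) zero x∉p = refl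
∣p[x]≔inside∣≡1+∣p∣ (inside ∷ p) (suc x) x∉p = cong suc (∣p[x]≔inside∣≡1+∣p∣ p x (x∉p ∘ there))
∣p[x]≔inside∣≡1+∣p∣ (outside ∷ p) (suc x) x∉p = ∣p[x]≔inside∣≡1+∣p∣ p x (x∉p ∘ there)

1+∣p[x]≔outside∣≡∣p∣ : ∀ (p : Subset k) x → x ∈ p → suc ∣ p [ x ]≔ outside ∣ ≡ ∣ p ∣
1+∣p[x]≔outside∣≡∣p∣ (inside ∷ p) zero x∈p = refl
1+∣p[x]≔outside∣≡∣p∣ (inside ∷ p) (suc x) (there x∈p) = cong suc (1+∣p[x]≔outside∣≡∣p∣ p x x∈p)
1+∣p[x]≔outside∣≡∣p∣ (outside ∷ p) (suc x) (there x∈p) = 1+∣p[x]≔outside∣≡∣p∣ p x x∈p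

p⊆p[x]≔inside : ∀ (p : Subset k) x → p ⊆ p [ x ]≔ inside
p⊆p[x]≔inside p x {y} y∈p with y ≟ x
... | yes refl = x∈p[x]≔inside p x
... | no y≢x = y∈p⇒y∈p[x]≔s inside y≢x y∈p

p⊆q⇒p[x]≔inside⊆q : ∀ {p q : Subset k} {x} → p ⊆ q → x ∈ q → p [ x ]≔ inside ⊆ q
p⊆q⇒p[x]≔inside⊆q {x = x} p⊆q x∈q {y} y∈ with y ≟ x
... | yes refl = x∈q
... | no y≢x = p⊆q (y∈p[x]≔s⇒y∈p inside y≢x y∈)

x∈p─q⇒x∉q : ∀ (p q : Subset k) {x} → x ∈ p ─ q → x ∉ q
x∈p─q⇒x∉q (_ ∷ p) (outside ∷ q) {zero} _ ()
x∈p─q⇒x∉q (_ ∷ p) (_ ∷ q) {suc x} (there x∈) (there x∈q) = x∈p─q⇒x∉q p q x∈ x∈q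

∣p∣<∣q∣⇒∃q∖p : ∀ (p q : Subset k) → ∣ p ∣ < ∣ q ∣ → ∃[ x ] (x ∈ q × x ∉ p)
∣p∣<∣q∣⇒∃q∖p p q ∣p∣<∣q∣ with any? (λ x → x ∈? q ×-dec ¬? (x ∈? p))
... | yes w = w
... | no ∄ = ⊥-elim (<-irrefl refl (<-≤-trans ∣p∣<∣q∣ (p⊆q⇒∣p∣≤∣q∣ q⊆p)))
  where
  q⊆p : q ⊆ p
  q⊆p {x} x∈q with x ∈? p
  ... | yes x∈p = x∈p
  ... | no x∉p = ⊥-elim (∄ (x , x∈q , x∉p))

p⊆q∧∣q∣≤∣p∣⇒q⊆p : ∀ {p q : Subset k} → p ⊆ q → ∣ q ∣ ≤ ∣ p ∣ → q ⊆ p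
p⊆q∧∣q∣≤∣p∣⇒q⊆p {p = p} p⊆q ∣q∣≤∣p∣ {x} x∈q with x ∈? p
... | yes x∈p = x∈p
... | no x∉p = ⊥-elim (<-irrefl refl (<-≤-trans (p⊂q⇒∣p∣<∣q∣ (p⊆q , x , x∈q , x∉p)) ∣q∣≤∣p∣))

exchange : Subset k → Fin k → Fin k → Subset k
exchange A r e = A [ r ]≔ outside [ e ]≔ inside

module _ {A : Subset k} {r e : Fin k} (r∈A : r ∈ A) (e∉A : e ∉ A) where

  e∈exchange : e ∈ exchange A r e
  e∈exchange = x∈p[x]≔inside _ e

  ∈-exchange⁺ : ∀ {x} → x ∈ A → x ≢ r → x ∈ exchange A r e
  ∈-exchange⁺ x∈A x≢r =
    y∈p⇒y∈p[x]≔s inside (λ { refl → e∉A x∈A }) (y∈p⇒y∈p[x]≔s outside x≢r x∈A)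

  ∈-exchange⁻ : ∀ {x} → x ∈ exchange A r e → x ≡ e ⊎ (x ∈ A × x ≢ r)
  ∈-exchange⁻ {x} x∈ with x ≟ e
  ... | yes x≡e = inj₁ x≡e
  ... | no x≢e = inj₂ (y∈p[x]≔outside⁻ (y∈p[x]≔s⇒y∈p inside x≢e x∈))

  r∉exchange : r ∉ exchange A r e
  r∉exchange r∈ with ∈-exchange⁻ r∈
  ... | inj₁ refl = e∉A r∈A
  ... | inj₂ (_ , r≢r) = r≢r refl

  ∣exchange∣≡∣A∣ : ∣ exchange A r e ∣ ≡ ∣ A ∣
  ∣exchange∣≡∣A∣ = trans (∣p[x]≔inside∣≡1+∣p∣ _ e (e∉A ∘ proj₁ ∘ y∈p[x]≔outside⁻))
                         (1+∣p[x]≔outside∣≡∣p∣ A r r∈A)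

  A─exchange≡⁅r⁆ : A ─ exchange A r e ≡ ⁅ r ⁆
  A─exchange≡⁅r⁆ = ⊆-antisym ⊆⁅r⁆ ⁅r⁆⊆
    where
    ⊆⁅r⁆ : A ─ exchange A r e ⊆ ⁅ r ⁆
    ⊆⁅r⁆ {x} x∈ with x ≟ r
    ... | yes refl = x∈⁅x⁆ r
    ... | no x≢r = ⊥-elim (x∈p─q⇒x∉q A _ x∈ (∈-exchange⁺ (p─q⊆p A _ x∈) x≢r))
    ⁅r⁆⊆ : ⁅ r ⁆ ⊆ A ─ exchange A r e
    ⁅r⁆⊆ x∈ with x∈⁅y⁆⇒x≡y r x∈
    ... | refl = x∈p∧x∉q⇒x∈p─q r∈A r∉exchange

  exchange─A≡⁅e⁆ : exchange A r e ─ A ≡ ⁅ e ⁆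
  exchange─A≡⁅e⁆ = ⊆-antisym ⊆⁅e⁆ ⁅e⁆⊆
    where
    ⊆⁅e⁆ : exchange A r e ─ A ⊆ ⁅ e ⁆
    ⊆⁅e⁆ x∈ with ∈-exchange⁻ (p─q⊆p _ A x∈)
    ... | inj₁ refl = x∈⁅x⁆ e
    ... | inj₂ (x∈A , _) = ⊥-elim (x∈p─q⇒x∉q _ A x∈ x∈A)
    ⁅e⁆⊆ : ⁅ e ⁆ ⊆ exchange A r e ─ A
    ⁅e⁆⊆ x∈ with x∈⁅y⁆⇒x≡y e x∈
    ... | refl = x∈p∧x∉q⇒x∈p─q e∈exchange e∉A

-- Lists without repetition

Unique⇒lookup-injective : ∀ {a} {X : Set a} {xs : List X} → Unique xs →
                          ∀ i j → lookup xs i ≡ lookup xs j → i ≡ j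
Unique⇒lookup-injective (_ ∷ _) zero zero _ = refl
Unique⇒lookup-injective (x≢ ∷ _) zero (suc j) eq = ⊥-elim (All.lookup x≢ (∈-lookup j) eq)
Unique⇒lookup-injective (x≢ ∷ _) (suc i) zero eq = ⊥-elim (All.lookup x≢ (∈-lookup i) (sym eq))
Unique⇒lookup-injective (_ ∷ u) (suc i) (suc j) eq = cong suc (Unique⇒lookup-injective u i j eq)

Unique⇒length≤ : ∀ {xs : List (Fin k)} → Unique xs → length xs ≤ k
Unique⇒length≤ {k} {xs} u with length xs ≤? k
... | yes ≤k = ≤k
... | no ≰k with pigeonhole (≰⇒> ≰k) (lookup xs)
...   | i , j , i<j , eq = ⊥-elim (Finₚ.<-irrefl (Unique⇒lookup-injective u i j eq) i<j)

Unique-++-∷⁻ : ∀ {a} {X : Set a} (xs : List X) {x ys} → Unique (xs ++ x ∷ ys) → x ∉ₗ xs ++ ys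
Unique-++-∷⁻ [] (x≢ ∷ _) x∈ = All.lookup x≢ x∈ refl
Unique-++-∷⁻ (y ∷ xs) (y≢ ∷ u) (here refl) = All.lookup y≢ (∈-++⁺ʳ xs (here refl)) refl
Unique-++-∷⁻ (y ∷ xs) (_ ∷ u) (there x∈) = Unique-++-∷⁻ xs u x∈

-- Walks

module _ (H : Digraph n m) where

  Joins-sym : ∀ {a x y} → Joins H a x y → Joins H a y x
  Joins-sym (inj₁ (t , h)) = inj₂ (h , t)
  Joins-sym (inj₂ (h , t)) = inj₁ (t , h)

  _++ʷ_ : ∀ {S x y z L₁ L₂} → UWalk H S x y L₁ → UWalk H S y z L₂ → UWalk H S x z (L₁ ++ L₂)
  [] ++ʷ w = w
  (s ∷ w₁) ++ʷ w₂ = s ∷ (w₁ ++ʷ w₂)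

  UWalk-map : ∀ {S S′ x y L} → (∀ {c} → c ∈ₗ L → c ∈ S → c ∈ S′) → UWalk H S x y L → UWalk H S′ x y L
  UWalk-map f [] = []
  UWalk-map f ((c∈S , j) ∷ w) = (f (here refl) c∈S , j) ∷ UWalk-map (f ∘ there) w

  UWalk-split : ∀ {S x y L e} → UWalk H S x y L → e ∈ₗ L →
    Σ[ p ∈ Fin n ] Σ[ q ∈ Fin n ] Σ[ L₁ ∈ List (Fin m) ] Σ[ L₂ ∈ List (Fin m) ]
      (L ≡ L₁ ++ e ∷ L₂ × UWalk H S x p L₁ × Joins H e p q × UWalk H S q y L₂)
  UWalk-split {x = x} ((_ , j) ∷ w) (here refl) = x , _ , [] , _ , refl , [] , j , w
  UWalk-split (s ∷ w) (there e∈) with UWalk-split w e∈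
  ... | p , q , L₁ , L₂ , refl , w₁ , j , w₂ = p , q , _ ∷ L₁ , L₂ , refl , s ∷ w₁ , j , w₂

  UAcyclic-⊆ : ∀ {S Q} → Q ⊆ S → UAcyclic H S → UAcyclic H Q
  UAcyclic-⊆ Q⊆S acyclic w = acyclic (UWalk-map (λ _ → Q⊆S) w)

  Closed : Subset m → (Fin n → Set) → Set
  Closed S D = ∀ {a x y} → a ∈ S → Joins H a x y → D x → D y

  UWalk-closed : ∀ {S D x y L} → Closed S D → UWalk H S x y L → (D x → D y) × (D y → D x)
  UWalk-closed closed [] = (λ d → d) , (λ d → d)
  UWalk-closed closed ((a∈S , j) ∷ w) with UWalk-closed closed w
  ... | fwd , bwd = fwd ∘ closed a∈S j , closed a∈S (Joins-sym j) ∘ bwd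

  UAcyclic-add : ∀ {S Q e} (D : Fin n → Set) → UAcyclic H Q → (∀ {c} → c ∈ S → c ≢ e → c ∈ Q) →
                 Closed Q D → D (head H e) → ¬ D (tail H e) → UAcyclic H S
  UAcyclic-add {S} {Q} {e} D acyclic S⊆Q closed Dh ¬Dt {as = L} w u with Any.any? (e ≟_) L
  ... | no e∉L = acyclic (UWalk-map (λ c∈L c∈S → S⊆Q c∈S λ { refl → e∉L c∈L }) w) u
  ... | yes e∈L with UWalk-split w e∈L
  ...   | p , q , L₁ , L₂ , refl , w₁ , j , w₂ = ⊥-elim (separated j (UWalk-closed closed wQ))
    where
    e∉ : ∀ {c} → c ∈ₗ L₂ ++ L₁ → c ≢ e
    e∉ c∈ refl = Unique-++-∷⁻ L₁ u ([ ∈-++⁺ʳ L₁ , ∈-++⁺ˡ ]′ (∈-++⁻ L₂ c∈))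
    wQ : UWalk H Q q p (L₂ ++ L₁)
    wQ = UWalk-map (λ c∈ c∈S → S⊆Q c∈S (e∉ c∈)) (w₂ ++ʷ w₁)
    separated : Joins H e p q → (D q → D p) × (D p → D q) → Empty
    separated (inj₁ (refl , refl)) (fwd , _) = ¬Dt (fwd Dh)
    separated (inj₂ (refl , refl)) (_ , bwd) = ¬Dt (bwd Dh)

  data DPath (S : Subset m) : Fin n → Fin n → List (Fin m) → Set where
    []  : ∀ {x} → DPath S x x []
    _∷_ : ∀ {a y L} → a ∈ S → DPath S (head H a) y L → DPath S (tail H a) y (a ∷ L)

  DPath⇒UWalk : ∀ {S x y L} → DPath S x y L → UWalk H S x y L
  DPath⇒UWalk [] = []
  DPath⇒UWalk (a∈S ∷ p) = (a∈S , inj₁ (refl , refl)) ∷ DPath⇒UWalk p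

  DPath-prefix : ∀ {S x y L b} → DPath S x y L → Unique L → b ∈ₗ L →
    Σ[ L₁ ∈ List (Fin m) ] (DPath S x (tail H b) L₁ × Unique (b ∷ L₁) × L₁ ⊆ₗ L)
  DPath-prefix (_ ∷ p) _ (here refl) = [] , [] , [] ∷ [] , λ ()
  DPath-prefix {b = b} (_∷_ {a} a∈S p) (a≢ ∷ u) (there b∈) with DPath-prefix p u b∈
  ... | L₁ , p₁ , b≢ ∷ u₁ , L₁⊆ =
    a ∷ L₁ , a∈S ∷ p₁ , (b≢a ∷ b≢) ∷ All.tabulate (All.lookup a≢ ∘ L₁⊆) ∷ u₁ ,
    λ { (here refl) → here refl ; (there c∈) → there (L₁⊆ c∈) }
    where
    b≢a : b ≢ a
    b≢a refl = All.lookup a≢ b∈ refl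

  Initial : Subset m → Fin m → Set
  Initial S c = c ∈ S × (∀ a → a ∈ S → head H a ≢ tail H c)

  -- Following predecessors backwards yields arc-disjoint directed paths of every length.
  UAcyclic⇒¬predecessors : ∀ {S b} → UAcyclic H S → b ∈ S →
    ¬ (∀ {c} → c ∈ S → ∃[ a ] (a ∈ S × head H a ≡ tail H c))
  UAcyclic⇒¬predecessors {S} {b} acyclic b∈S predecessor = too-long (path (suc m))
    where
    Path : ℕ → Set
    Path t = Σ[ x ∈ Fin n ] Σ[ y ∈ Fin n ] Σ[ L ∈ List (Fin m) ]
      (DPath S x y L × Unique L × length L ≡ t × ∃[ a ] (a ∈ S × head H a ≡ x))

    extend : ∀ {t} → Path t → Path (suc t)
    extend (_ , y , L , p , u , refl , a , a∈S , refl) with Any.any? (a ≟_) L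
    ... | no a∉L = tail H a , y , a ∷ L , a∈S ∷ p , ¬Any⇒All¬ L a∉L ∷ u , refl , predecessor a∈S
    ... | yes a∈L with DPath-prefix p u a∈L
    ...   | L₁ , p₁ , u₁ , _ with acyclic (DPath⇒UWalk (a∈S ∷ p₁)) u₁
    ...     | ()

    path : ∀ t → Path t
    path zero = tail H b , tail H b , [] , [] , [] , refl , predecessor b∈S
    path (suc t) = extend (path t)

    too-long : Path (suc m) → Empty
    too-long (_ , _ , _ , _ , u , len , _) = <-irrefl refl (subst (_≤ m) len (Unique⇒length≤ u))

  UAcyclic⇒∃Initial : ∀ {S b} → UAcyclic H S → b ∈ S → ∃[ c ] Initial S c
  UAcyclic⇒∃Initial {S} acyclic b∈S
    with any? (λ c → c ∈? S ×-dec all? (λ a → a ∈? S →-dec ¬? (head H a ≟ tail H c)))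
  ... | yes initial = initial
  ... | no ∄initial = ⊥-elim (UAcyclic⇒¬predecessors acyclic b∈S predecessor)
    where
    predecessor : ∀ {c} → c ∈ S → ∃[ a ] (a ∈ S × head H a ≡ tail H c)
    predecessor {c} c∈S with any? (λ a → a ∈? S ×-dec head H a ≟ tail H c)
    ... | yes a = a
    ... | no ∄a = ⊥-elim (∄initial (c , c∈S , λ a a∈S eq → ∄a (a , a∈S , eq)))

  data Reachable (S : Subset m) (v : Fin n) : Fin n → Set where
    start : Reachable S v v
    step  : ∀ {a} → a ∈ S → Reachable S v (tail H a) → Reachable S v (head H a)

  Reachable-tail : ∀ {S v y c} → InDeg≤1 H S → c ∈ S → Reachable S v y → head H c ≡ y → y ≢ v →
                   Reachable S v (tail H c)
  Reachable-tail inDeg≤1 c∈S start _ y≢v = ⊥-elim (y≢v refl)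
  Reachable-tail inDeg≤1 c∈S (step b∈S reach) hc _ with inDeg≤1 _ _ b∈S c∈S (sym hc)
  ... | refl = reach

converse : Digraph n m → Digraph n m
converse H = record { tail = head H ; head = tail H }

UAcyclic-converse : ∀ (H : Digraph n m) {S} → UAcyclic H S → UAcyclic (converse H) S
UAcyclic-converse H acyclic w = acyclic (unconverse w)
  where
  unconverse : ∀ {S x y L} → UWalk (converse H) S x y L → UWalk H S x y L
  unconverse [] = []
  unconverse ((a∈S , j) ∷ w) = (a∈S , swap j) ∷ unconverse w

-- Reconfiguration sequences

Adjacent : Subgraph n m → Subgraph n m → Set
Adjacent F F₁ = ∣ A F ─ A F₁ ∣ ≡ 1 × ∣ A F₁ ─ A F ∣ ≡ 1

module Reconfigurations {n m : ℕ} (Valid : Subgraph n m → Set) where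

  Reconfiguration : ℕ → Subgraph n m → Subgraph n m → Set
  Reconfiguration k F F′ = Σ[ ℓ ∈ ℕ ] Σ[ Fs ∈ (Fin (suc ℓ) → Subgraph n m) ]
    (Fs zero ≡ F × Fs (fromℕ ℓ) ≡ F′ × (∀ i → Valid (Fs i))
     × (∀ (i : Fin ℓ) → Adjacent (Fs (inject₁ i)) (Fs (suc i))) × ℓ ≤ k)

  Reconfiguration-refl : ∀ {F} → Valid F → Reconfiguration 0 F F
  Reconfiguration-refl {F = F} valid = 0 , (λ _ → F) , refl , refl , (λ _ → valid) , (λ ()) , z≤n

  Reconfiguration-suc : ∀ {k F F′} → Reconfiguration k F F′ → Reconfiguration (suc k) F F′
  Reconfiguration-suc (ℓ , Fs , first , last , valid , adjacent , ℓ≤k) =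
    ℓ , Fs , first , last , valid , adjacent , m≤n⇒m≤1+n ℓ≤k

  Reconfiguration-∷ : ∀ {k F F₁ F′} → Valid F → Adjacent F F₁ →
                      Reconfiguration k F₁ F′ → Reconfiguration (suc k) F F′
  Reconfiguration-∷ {F = F} validF F~F₁ (ℓ , Fs , refl , last , valid , adjacent , ℓ≤k) =
    suc ℓ , Fs′ , refl , last , valid′ , adjacent′ , s≤s ℓ≤k
    where
    Fs′ : Fin (suc (suc ℓ)) → Subgraph n m
    Fs′ zero = F
    Fs′ (suc i) = Fs i
    valid′ : ∀ i → Valid (Fs′ i)
    valid′ zero = validF
    valid′ (suc i) = valid i
    adjacent′ : ∀ (i : Fin (suc ℓ)) → Adjacent (Fs′ (inject₁ i)) (Fs′ (suc i))
    adjacent′ zero = F~F₁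
    adjacent′ (suc i) = adjacent i

exchange-Adjacent : ∀ {F : Subgraph n m} {V₁ r e} → r ∈ A F → e ∉ A F →
                    Adjacent F ⟨ V₁ , exchange (A F) r e ⟩
exchange-Adjacent {r = r} {e} r∈A e∉A =
  trans (cong ∣_∣ (A─exchange≡⁅r⁆ r∈A e∉A)) (∣⁅x⁆∣≡1 r) ,
  trans (cong ∣_∣ (exchange─A≡⁅e⁆ r∈A e∉A)) (∣⁅x⁆∣≡1 e)

-- Directed forests

module _ (G : Digraph n m) (R : Subset n) where

  Reached : Subset m → Fin n → Set
  Reached P x = x ∈ R ⊎ ∃[ p ] (p ∈ P × head G p ≡ x)

  Rooted : Subset m → Set
  Rooted P = ∀ p → p ∈ P → Reached P (tail G p)

  Reached-⊆ : ∀ {P P′ x} → P ⊆ P′ → Reached P x → Reached P′ x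
  Reached-⊆ _ (inj₁ x∈R) = inj₁ x∈R
  Reached-⊆ P⊆P′ (inj₂ (p , p∈P , hp)) = inj₂ (p , P⊆P′ p∈P , hp)

  Rooted-insert : ∀ {P e} → Rooted P → Reached P (tail G e) → Rooted (P [ e ]≔ inside)
  Rooted-insert {P} {e} rooted reached p p∈ with p ≟ e
  ... | yes refl = Reached-⊆ (p⊆p[x]≔inside P e) reached
  ... | no p≢e = Reached-⊆ (p⊆p[x]≔inside P e) (rooted p (y∈p[x]≔s⇒y∈p inside p≢e p∈))

  module RForest {F : Subgraph n m} (rdf : RDirectedForest G R F) where

    endpoints : IsSubgraph G F
    endpoints = proj₁ (proj₁ rdf)

    acyclic : UAcyclic G (A F)
    acyclic = proj₁ (proj₂ (proj₁ rdf))

    inDeg≤1 : InDeg≤1 G (A F)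
    inDeg≤1 = proj₂ (proj₂ (proj₁ rdf))

    root∈V : ∀ {x} → x ∈ R → x ∈ V F
    root∈V {x} x∈R = proj₁ (proj₁ (proj₂ rdf x) x∈R)

    head∉R : ∀ {a} → a ∈ A F → head G a ∉ R
    head∉R {a} a∈A h∈R = proj₂ (proj₁ (proj₂ rdf (head G a)) h∈R) a a∈A refl

    inArc : ∀ {x} → x ∈ V F → x ∉ R → ∃[ a ] (a ∈ A F × head G a ≡ x)
    inArc {x} x∈V x∉R with any? (λ a → a ∈? A F ×-dec head G a ≟ x)
    ... | yes a = a
    ... | no ∄a = ⊥-elim (x∉R (proj₂ (proj₂ rdf x) x∈V λ a a∈A ha → ∄a (a , a∈A , ha)))

    Reached⇒∈V : ∀ {P x} → P ⊆ A F → Reached P x → x ∈ V F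
    Reached⇒∈V _ (inj₁ x∈R) = root∈V x∈R
    Reached⇒∈V P⊆A (inj₂ (p , p∈P , refl)) = proj₂ (endpoints p (P⊆A p∈P))

    Reached-head⇒∈ : ∀ {P a} → P ⊆ A F → a ∈ A F → Reached P (head G a) → a ∈ P
    Reached-head⇒∈ _ a∈A (inj₁ h∈R) = ⊥-elim (head∉R a∈A h∈R)
    Reached-head⇒∈ P⊆A a∈A (inj₂ (p , p∈P , hp)) with inDeg≤1 p _ (P⊆A p∈P) a∈A hp
    ... | refl = p∈P

    Reachable⇒¬Reached : ∀ {P v x} → P ⊆ A F → Rooted P → ¬ Reached P v →
                         Reachable G (A F) v x → ¬ Reached P x
    Reachable⇒¬Reached _ _ ¬reached start = ¬reached
    Reachable⇒¬Reached P⊆A rooted ¬reached (step a∈A reach) reached =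
      Reachable⇒¬Reached P⊆A rooted ¬reached reach (rooted _ (Reached-head⇒∈ P⊆A a∈A reached))

    ∃extension : ∀ {P} → P ⊆ A F → ∣ P ∣ < ∣ A F ∣ → ∃[ e ] (e ∈ A F × e ∉ P × Reached P (tail G e))
    ∃extension {P} P⊆A ∣P∣<∣A∣ with ∣p∣<∣q∣⇒∃q∖p P (A F) ∣P∣<∣A∣
    ... | b , b∈A , b∉P
      with UAcyclic⇒∃Initial G (UAcyclic-⊆ G (p─q⊆p (A F) P) acyclic) (x∈p∧x∉q⇒x∈p─q b∈A b∉P)
    ...   | e , e∈ , initial = e , p─q⊆p _ P e∈ , x∈p─q⇒x∉q _ P e∈ , reached
      where
      reached : Reached P (tail G e)
      reached with tail G e ∈? R
      ... | yes t∈R = inj₁ t∈R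
      ... | no t∉R with inArc (proj₁ (endpoints e (p─q⊆p _ P e∈))) t∉R
      ...   | a , a∈A , ha with a ∈? P
      ...     | yes a∈P = inj₂ (a , a∈P , ha)
      ...     | no a∉P = ⊥-elim (initial a (x∈p∧x∉q⇒x∈p─q a∈A a∉P) ha)

    ∃leaf∉ : ∀ {P} → P ⊆ A F → Rooted P → ∣ P ∣ < ∣ A F ∣ →
             ∃[ c ] (c ∈ A F × c ∉ P × ∀ {b} → b ∈ A F → tail G b ≢ head G c)
    ∃leaf∉ {P} P⊆A rooted ∣P∣<∣A∣ with ∣p∣<∣q∣⇒∃q∖p P (A F) ∣P∣<∣A∣
    ... | b , b∈A , b∉P
      with UAcyclic⇒∃Initial (converse G)
             (UAcyclic-⊆ (converse G) (p─q⊆p (A F) P) (UAcyclic-converse G acyclic))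
             (x∈p∧x∉q⇒x∈p─q b∈A b∉P)
    ...   | c , c∈ , initial = c , c∈A , c∉P , leaf
      where
      c∈A = p─q⊆p (A F) P c∈
      c∉P = x∈p─q⇒x∉q (A F) P c∈
      leaf : ∀ {b} → b ∈ A F → tail G b ≢ head G c
      leaf {b} b∈A with b ∈? P
      ... | yes b∈P = λ t≡z → c∉P (Reached-head⇒∈ P⊆A c∈A (subst (Reached P) t≡z (rooted b b∈P)))
      ... | no b∉P = initial b (x∈p∧x∉q⇒x∈p─q b∈A b∉P)

  RDirectedForest-V⊆ : ∀ {F F₁} → RDirectedForest G R F → RDirectedForest G R F₁ →
                       A F ≡ A F₁ → V F ⊆ V F₁
  RDirectedForest-V⊆ rdf rdf₁ refl {x} x∈V with x ∈? R
  ... | yes x∈R = RForest.root∈V rdf₁ x∈R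
  ... | no x∉R with RForest.inArc rdf x∈V x∉R
  ...   | a , a∈A , refl = proj₂ (RForest.endpoints rdf₁ a a∈A)

  RDirectedForest-≡ : ∀ {F F₁} → RDirectedForest G R F → RDirectedForest G R F₁ → A F ≡ A F₁ → F ≡ F₁
  RDirectedForest-≡ rdf rdf₁ A≡A₁ =
    cong₂ ⟨_,_⟩ (⊆-antisym (RDirectedForest-V⊆ rdf rdf₁ A≡A₁) (RDirectedForest-V⊆ rdf₁ rdf (sym A≡A₁))) A≡A₁

  module _ {V : Subset n} {A : Subset m} {r e} (rdf : RDirectedForest G R ⟨ V , A ⟩)
           (r∈A : r ∈ A) (e∉A : e ∉ A) where
    open RForest rdf

    InDeg≤1-exchange : (∀ {b} → b ∈ A → b ≢ r → head G b ≢ head G e) → InDeg≤1 G (exchange A r e)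
    InDeg≤1-exchange head≢ b b′ b∈ b′∈ hb with ∈-exchange⁻ r∈A e∉A b∈ | ∈-exchange⁻ r∈A e∉A b′∈
    ... | inj₁ refl | inj₁ refl = refl
    ... | inj₁ refl | inj₂ (b′∈A , b′≢r) = ⊥-elim (head≢ b′∈A b′≢r (sym hb))
    ... | inj₂ (b∈A , b≢r) | inj₁ refl = ⊥-elim (head≢ b∈A b≢r hb)
    ... | inj₂ (b∈A , _) | inj₂ (b′∈A , _) = inDeg≤1 b b′ b∈A b′∈A hb

    RootsAre-exchange : ∀ {V₁} → head G e ∉ R → (∀ {x} → x ∈ R → x ∈ V₁) →
                        (∀ {x} → x ∈ V₁ → x ≡ head G e ⊎ (x ∈ V × head G r ≢ x)) →
                        RootsAre G R ⟨ V₁ , exchange A r e ⟩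
    RootsAre-exchange {V₁} he∉R R⊆V₁ V₁⊆ x = (λ x∈R → R⊆V₁ x∈R , inDeg0 x∈R) , root
      where
      inDeg0 : x ∈ R → InDeg0 G (exchange A r e) x
      inDeg0 x∈R b b∈ refl with ∈-exchange⁻ r∈A e∉A b∈
      ... | inj₁ refl = he∉R x∈R
      ... | inj₂ (b∈A , _) = head∉R b∈A x∈R
      root : x ∈ V₁ → InDeg0 G (exchange A r e) x → x ∈ R
      root x∈V₁ inDeg0₁ with V₁⊆ x∈V₁
      ... | inj₁ refl = ⊥-elim (inDeg0₁ e (e∈exchange r∈A e∉A) refl)
      ... | inj₂ (x∈V , hr≢x) = proj₂ (proj₂ rdf x) x∈V inDeg0A
        where
        inDeg0A : InDeg0 G A x
        inDeg0A b b∈A hb with b ≟ r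
        ... | yes refl = hr≢x hb
        ... | no b≢r = inDeg0₁ b (∈-exchange⁺ r∈A e∉A b∈A b≢r) hb

    UAcyclic-exchange : (D : Fin n → Set) → Closed G (A [ r ]≔ outside) D →
                        D (head G e) → ¬ D (tail G e) → UAcyclic G (exchange A r e)
    UAcyclic-exchange D =
      UAcyclic-add G D (UAcyclic-⊆ G (proj₁ ∘ y∈p[x]≔outside⁻) acyclic)
        (λ c∈ c≢e → y∈p[x]≔s⇒y∈p inside c≢e c∈)

  replace-in-arc : ∀ {V A e} → RDirectedForest G R ⟨ V , A ⟩ → e ∉ A →
                   tail G e ∈ V → head G e ∈ V → head G e ∉ R → ¬ Reachable G A (head G e) (tail G e) →
                   ∃[ a ] (a ∈ A × head G a ≡ head G e × RDirectedForest G R ⟨ V , exchange A a e ⟩)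
  replace-in-arc {V} {A} {e} rdf e∉A t∈V h∈V h∉R unreachable with RForest.inArc rdf h∈V h∉R
  ... | a , a∈A , ha = a , a∈A , ha , (endpoints₁ , acyclic₁ , inDeg≤1₁) , roots₁
    where
    open RForest rdf

    enters-head-e⇒≡a : ∀ {b} → b ∈ A → head G b ≡ head G e → b ≡ a
    enters-head-e⇒≡a b∈A hb = inDeg≤1 _ a b∈A a∈A (trans hb (sym ha))

    endpoints₁ : IsSubgraph G ⟨ V , exchange A a e ⟩
    endpoints₁ b b∈ with ∈-exchange⁻ a∈A e∉A b∈
    ... | inj₁ refl = t∈V , h∈V
    ... | inj₂ (b∈A , _) = endpoints b b∈A

    closed : Closed G (A [ a ]≔ outside) (Reachable G A (head G e))
    closed c∈ (inj₁ (refl , refl)) reach = step (proj₁ (y∈p[x]≔outside⁻ c∈)) reach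
    closed c∈ (inj₂ (refl , refl)) reach with y∈p[x]≔outside⁻ c∈
    ... | c∈A , c≢a = Reachable-tail G inDeg≤1 c∈A reach refl (c≢a ∘ enters-head-e⇒≡a c∈A)

    acyclic₁ : UAcyclic G (exchange A a e)
    acyclic₁ = UAcyclic-exchange rdf a∈A e∉A (Reachable G A (head G e)) closed start unreachable

    inDeg≤1₁ : InDeg≤1 G (exchange A a e)
    inDeg≤1₁ = InDeg≤1-exchange rdf a∈A e∉A λ b∈A b≢a → b≢a ∘ enters-head-e⇒≡a b∈A

    roots₁ : RootsAre G R ⟨ V , exchange A a e ⟩
    roots₁ = RootsAre-exchange rdf a∈A e∉A h∉R root∈V V⊆
      where
      V⊆ : ∀ {x} → x ∈ V → x ≡ head G e ⊎ (x ∈ V × head G a ≢ x)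
      V⊆ {x} x∈V with x ≟ head G e
      ... | yes x≡h = inj₁ x≡h
      ... | no x≢h = inj₂ (x∈V , λ ha≡x → x≢h (trans (sym ha≡x) ha))

  replace-leaf : ∀ {V A c e} → RDirectedForest G R ⟨ V , A ⟩ →
                 c ∈ A → (∀ {b} → b ∈ A → tail G b ≢ head G c) → e ∉ A → tail G e ∈ V → tail G e ≢ head G c → head G e ∉ V →
                 RDirectedForest G R ⟨ exchange V (head G c) (head G e) , exchange A c e ⟩
  replace-leaf {V} {A} {c} {e} rdf c∈A leaf e∉A t∈V t≢z h∉V =
    (endpoints₁ , acyclic₁ , inDeg≤1₁) , roots₁
    where
    open RForest rdf

    z∈V : head G c ∈ V
    z∈V = proj₂ (endpoints c c∈A)

    V⊆V₁ : ∀ {x} → x ∈ V → x ≢ head G c → x ∈ exchange V (head G c) (head G e)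
    V⊆V₁ = ∈-exchange⁺ z∈V h∉V

    endpoints₁ : IsSubgraph G ⟨ exchange V (head G c) (head G e) , exchange A c e ⟩
    endpoints₁ b b∈ with ∈-exchange⁻ c∈A e∉A b∈
    ... | inj₁ refl = V⊆V₁ t∈V t≢z , e∈exchange z∈V h∉V
    ... | inj₂ (b∈A , b≢c) =
      V⊆V₁ (proj₁ (endpoints b b∈A)) (leaf b∈A) ,
      V⊆V₁ (proj₂ (endpoints b b∈A)) (b≢c ∘ inDeg≤1 b c b∈A c∈A)

    closed : Closed G (A [ c ]≔ outside) (_∉ V)
    closed b∈ (inj₁ (refl , refl)) t∉V = ⊥-elim (t∉V (proj₁ (endpoints _ (proj₁ (y∈p[x]≔outside⁻ b∈)))))
    closed b∈ (inj₂ (refl , refl)) h∉V′ = ⊥-elim (h∉V′ (proj₂ (endpoints _ (proj₁ (y∈p[x]≔outside⁻ b∈)))))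

    acyclic₁ : UAcyclic G (exchange A c e)
    acyclic₁ = UAcyclic-exchange rdf c∈A e∉A (_∉ V) closed h∉V (λ t∉V → t∉V t∈V)

    inDeg≤1₁ : InDeg≤1 G (exchange A c e)
    inDeg≤1₁ = InDeg≤1-exchange rdf c∈A e∉A λ b∈A _ hb → h∉V (subst (_∈ V) hb (proj₂ (endpoints _ b∈A)))

    roots₁ : RootsAre G R ⟨ exchange V (head G c) (head G e) , exchange A c e ⟩
    roots₁ = RootsAre-exchange rdf c∈A e∉A (h∉V ∘ root∈V)
      (λ x∈R → V⊆V₁ (root∈V x∈R) λ { refl → head∉R c∈A x∈R })
      (λ x∈ → map₂ (λ (x∈V , x≢z) → x∈V , x≢z ∘ sym) (∈-exchange⁻ z∈V h∉V x∈))

  module _ {F′ : Subgraph n m} (rdf′ : RDirectedForest G R F′) where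
    open Reconfigurations (RDirectedForest G R)
    private
      module Target = RForest rdf′

    exchange-arc : ∀ {F P e} → RDirectedForest G R F → P ⊆ A F → P ⊆ A F′ → Rooted P →
                   e ∈ A F′ → e ∉ P → e ∉ A F → Reached P (tail G e) → ∣ P ∣ < ∣ A F ∣ →
                   ∃[ r ] ∃[ V₁ ] (r ∈ A F × r ∉ P × RDirectedForest G R ⟨ V₁ , exchange (A F) r e ⟩)
    exchange-arc {F} {P} {e} rdf P⊆A P⊆A′ rooted e∈A′ e∉P e∉A reached ∣P∣<∣A∣ = by-cases (head G e ∈? V F)
      where
      open RForest rdf

      t∈V : tail G e ∈ V F
      t∈V = Reached⇒∈V P⊆A reached

      ¬reached-h : ¬ Reached P (head G e)
      ¬reached-h = e∉P ∘ Target.Reached-head⇒∈ P⊆A′ e∈A′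

      by-cases : Dec (head G e ∈ V F) →
                 ∃[ r ] ∃[ V₁ ] (r ∈ A F × r ∉ P × RDirectedForest G R ⟨ V₁ , exchange (A F) r e ⟩)
      by-cases (yes h∈V) with replace-in-arc rdf e∉A t∈V h∈V (Target.head∉R e∈A′)
                                (λ reach → Reachable⇒¬Reached P⊆A rooted ¬reached-h reach reached)
      ... | a , a∈A , ha , rdf₁ = a , V F , a∈A , a∉P , rdf₁
        where
        a∉P : a ∉ P
        a∉P a∈P = ¬reached-h (inj₂ (a , a∈P , ha))
      by-cases (no h∉V) with ∃leaf∉ P⊆A rooted ∣P∣<∣A∣
      ... | c , c∈A , c∉P , leaf =
        c , exchange (V F) (head G c) (head G e) , c∈A , c∉P , replace-leaf rdf c∈A leaf e∉A t∈V t≢z h∉V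
        where
        t≢z : tail G e ≢ head G c
        t≢z t≡z = c∉P (Reached-head⇒∈ P⊆A c∈A (subst (Reached P) t≡z reached))

    reconfigure : ∀ d {F} P → RDirectedForest G R F → ∣ A F ∣ ≡ ∣ A F′ ∣ → P ⊆ A F → P ⊆ A F′ →
                  Rooted P → ∣ P ∣ + d ≡ ∣ A F′ ∣ → Reconfiguration d F F′
    reconfigure zero {F} P rdf ∣A∣≡ P⊆A P⊆A′ _ ∣P∣≡ =
      subst (Reconfiguration 0 F) (RDirectedForest-≡ rdf rdf′ A≡A′) (Reconfiguration-refl rdf)
      where
      A′⊆A : A F′ ⊆ A F
      A′⊆A x∈ = P⊆A (p⊆q∧∣q∣≤∣p∣⇒q⊆p P⊆A′ (≤-reflexive (trans (sym ∣P∣≡) (+-identityʳ ∣ P ∣))) x∈)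
      A≡A′ : A F ≡ A F′
      A≡A′ = ⊆-antisym (p⊆q∧∣q∣≤∣p∣⇒q⊆p A′⊆A (≤-reflexive ∣A∣≡)) A′⊆A
    reconfigure (suc d) {F} P rdf ∣A∣≡ P⊆A P⊆A′ rooted ∣P∣≡ = extend-by (Target.∃extension P⊆A′ ∣P∣<∣A′∣)
      where
      ∣P∣<∣A′∣ : ∣ P ∣ < ∣ A F′ ∣
      ∣P∣<∣A′∣ = subst (∣ P ∣ <_) ∣P∣≡ (m<m+n ∣ P ∣ (s≤s z≤n))

      continue : ∀ {F₁ e} → RDirectedForest G R F₁ → ∣ A F₁ ∣ ≡ ∣ A F′ ∣ → P ⊆ A F₁ →
                 e ∈ A F₁ → e ∈ A F′ → e ∉ P → Reached P (tail G e) → Reconfiguration d F₁ F′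
      continue {e = e} rdf₁ ∣A₁∣≡ P⊆A₁ e∈A₁ e∈A′ e∉P reached =
        reconfigure d (P [ e ]≔ inside) rdf₁ ∣A₁∣≡
          (p⊆q⇒p[x]≔inside⊆q P⊆A₁ e∈A₁) (p⊆q⇒p[x]≔inside⊆q P⊆A′ e∈A′) (Rooted-insert rooted reached)
          (trans (cong (_+ d) (∣p[x]≔inside∣≡1+∣p∣ P e e∉P)) (trans (sym (+-suc ∣ P ∣ d)) ∣P∣≡))

      extend-by : ∃[ e ] (e ∈ A F′ × e ∉ P × Reached P (tail G e)) → Reconfiguration (suc d) F F′
      extend-by (e , e∈A′ , e∉P , reached) with e ∈? A F
      ... | yes e∈A = Reconfiguration-suc (continue rdf ∣A∣≡ P⊆A e∈A e∈A′ e∉P reached)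
      ... | no e∉A with exchange-arc rdf P⊆A P⊆A′ rooted e∈A′ e∉P e∉A reached
                          (subst (∣ P ∣ <_) (sym ∣A∣≡) ∣P∣<∣A′∣)
      ...   | r , V₁ , r∈A , r∉P , rdf₁ =
        Reconfiguration-∷ rdf (exchange-Adjacent {F = F} {V₁ = V₁} r∈A e∉A)
          (continue rdf₁ (trans (∣exchange∣≡∣A∣ r∈A e∉A) ∣A∣≡) P⊆A₁ (e∈exchange r∈A e∉A) e∈A′ e∉P reached)
        where
        P⊆A₁ : P ⊆ exchange (A F) r e
        P⊆A₁ x∈P = ∈-exchange⁺ r∈A e∉A (P⊆A x∈P) λ { refl → r∉P x∈P }

theorem6 : ∀ {n m} (G : Digraph n m) (R : Subset n) (F F′ : Subgraph n m) (k : ℕ) →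
    RDirectedForest G R F → RDirectedForest G R F′ →
    size G F ≡ k → size G F′ ≡ k →
    Σ[ ℓ ∈ ℕ ] Σ[ Fs ∈ (Fin (suc ℓ) → Subgraph n m) ] (Fs zero ≡ F × Fs (fromℕ ℓ) ≡ F′
      × (∀ (i : Fin (suc ℓ)) → RDirectedForest G R (Fs i))
      × (∀ (i : Fin ℓ) → ∣ A (Fs (inject₁ i)) ─ A (Fs (suc i)) ∣ ≡ 1
                       × ∣ A (Fs (suc i)) ─ A (Fs (inject₁ i)) ∣ ≡ 1)
      × ℓ ≤ k)
theorem6 {m = m} G R F F′ k rdf rdf′ ∣A∣≡k ∣A′∣≡k =
  reconfigure G R rdf′ k ⊥ rdf (trans ∣A∣≡k (sym ∣A′∣≡k)) (⊆-min _) (⊆-min _) (λ _ p∈⊥ → ⊥-elim (∉⊥ p∈⊥))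
    (trans (cong (_+ k) (∣⊥∣≡0 m)) (sym ∣A′∣≡k))
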